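{- If $P$ and $Q$ are $\mathbf{R}$-healthy and the merge predicate $M$ is $\mathbf{R}_m$-healthy, then $P \parallel_M Q$ is $\mathbf{R}$-healthy.
   Context: Fix a trace algebra $(\mathcal{T}, \frown, \langle\rangle)$: a set with associative $\frown$, two-sided unit $\langle\rangle$, left and right cancellation, and $x \frown y = \langle\rangle \Rightarrow x = \langle\rangle$. Prefix: $x \le y \iff \exists z.\ y = x \frown z$; subtraction: $y - x$ is the unique $z$ with $y = x \frown z$ if $x \le y$, else $\langle\rangle$. Predicates are relations (formulas identified up to logical equivalence) over unprimed variables $v$ and primed variables $v'$, including $wait, wait' : \mathbb{B}$, $tr, tr' : \mathcal{T}$ and other state variables. Sequential composition: $P \,;\, Q \triangleq \exists v_0.\ P[v_0/v'] \land Q[v_0/v]$. Conditional: $P \lhd b \rhd Q \triangleq (b \land P) \lor (\lnot b \land Q)$. $\mathit{II}$ is $v' = v$. $\mathbf{R1}(P) \triangleq P \land tr \le tr'$; $\mathbf{R2}_c(P) \triangleq P[\langle\rangle, tr' - tr / tr, tr'] \lhd tr \le tr' \rhd P$; $\mathbf{R3}(P) \triangleq \mathit{II} \lhd wait \rhd P$; $\mathbf{R} \triangleq \mathbf{R3} \circ \mathbf{R2}_c \circ \mathbf{R1}$; $P$ is $\mathbf{H}$-healthy if $\mathbf{H}(P)=P$. For a predicate $P$ and $n \in \{0,1\}$, $\langle P \rangle_n$ is $P$ with every after-variable $x'$ renamed to an indexed variable $n.x$. A merge predicate $M$ is a relation whose before-state consists of the variables $v$ together with the indexed copies $0.v$ and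 $1.v$, and whose after-state consists of $v'$. Parallel-by-merge: $P \parallel_M Q \triangleq (\langle P\rangle_0 \land \langle Q\rangle_1 \land v' = v) \,;\, M$, where the sequential composition identifies the after-state $(v', 0.v, 1.v)$ of the left operand with the before-state $(v, 0.v, 1.v)$ of $M$. On merge predicates, $\mathbf{R1}(M) = M \land tr \le tr'$, $\mathbf{R3}(M) = \mathit{II} \lhd wait \rhd M$, and $\mathbf{R2}_m(M) \triangleq M[\langle\rangle, tr' - tr, 0.tr - tr, 1.tr - tr \,/\, tr, tr', 0.tr, 1.tr] \lhd tr \le tr' \rhd M$ (simultaneous substitution). $\mathbf{R}_m \triangleq \mathbf{R1} \circ \mathbf{R2}_m \circ \mathbf{R3}$. -}

module Defs where

open import Data.Bool using (Bool; true; false)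
open import Data.Product using (Σ; _×_; _,_; ∃)
open import Data.Sum using (_⊎_)
open import Relation.Nullary using (¬_)
open import Relation.Binary.PropositionalEquality using (_≡_)
open import Function.Bundles using (_⇔_)

record TraceAlgebra : Set₁ where
  infixr 5 _⌢_
  infix 4 _≤_
  infixl 6 _-_
  field
    T      : Set
    _⌢_    : T → T → T
    ⟨⟩     : T
    assoc  : ∀ x y z → (x ⌢ y) ⌢ z ≡ x ⌢ (y ⌢ z)
    unitˡ  : ∀ x → ⟨⟩ ⌢ x ≡ x
    unitʳ  : ∀ x → x ⌢ ⟨⟩ ≡ x
    cancelˡ : ∀ x y z → x ⌢ y ≡ x ⌢ z → y ≡ z
    cancelʳ : ∀ x y z → y ⌢ x ≡ z ⌢ x → y ≡ z
    empty  : ∀ x y → x ⌢ y ≡ ⟨⟩ → x ≡ ⟨⟩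

  _≤_ : T → T → Set
  x ≤ y = ∃ λ z → y ≡ x ⌢ z

  -- subtraction y - x: the unique z with y = x ⌢ z if x ≤ y, else ⟨⟩
  -- (uniqueness of such z follows from left cancellation)
  field
    _-_     : T → T → T
    -‿≤     : ∀ x y → x ≤ y → y ≡ x ⌢ (y - x)
    -‿≰     : ∀ x y → ¬ (x ≤ y) → y - x ≡ ⟨⟩

module Theory (𝒯 : TraceAlgebra) (S : Set) where
  open TraceAlgebra 𝒯

  record State : Set where
    constructor st
    field
      wait : Bool
      tr   : T
      rest : S
  open State public

  setTr : State → T → State
  setTr (st w _ r) t = st w t r

  -- Predicates: relations between before-state v and after-state v'
  -- (identified up to logical equivalence).
  Pred : Set₁
  Pred = State → State → Set

  -- Merge predicates: before-state (v, 0.v, 1.v), after-state v'.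
  MergePred : Set₁
  MergePred = State → State → State → State → Set

  _◁_▷_ : Set → Set → Set → Set
  P ◁ b ▷ Q = (b × P) ⊎ (¬ b × Q)

  II : Pred
  II v v' = v' ≡ v

  _≅_ : Pred → Pred → Set
  P ≅ Q = ∀ v v' → P v v' ⇔ Q v v'

  _≅ₘ_ : MergePred → MergePred → Set
  M ≅ₘ N = ∀ v v₀ v₁ v' → M v v₀ v₁ v' ⇔ N v v₀ v₁ v'

  R1 : Pred → Pred
  R1 P v v' = P v v' × (tr v ≤ tr v')

  R2c : Pred → Pred
  R2c P v v' =
    P (setTr v ⟨⟩) (setTr v' (tr v' - tr v)) ◁ (tr v ≤ tr v') ▷ P v v'

  R3 : Pred → Pred
  R3 P v v' = II v v' ◁ (wait v ≡ true) ▷ P v v'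

  R : Pred → Pred
  R P = R3 (R2c (R1 P))

  Healthy : (Pred → Pred) → Pred → Set
  Healthy H P = H P ≅ P

  -- Parallel-by-merge:
  -- (⟨P⟩₀ ∧ ⟨Q⟩₁ ∧ v' = v) ; M, composing over the intermediate
  -- state (v_m, 0.v, 1.v).
  ParMerge : Pred → MergePred → Pred → Pred
  ParMerge P M Q v v' =
    Σ State λ v₀ → Σ State λ v₁ → Σ State λ vₘ →
      P v v₀ × Q v v₁ × vₘ ≡ v × M vₘ v₀ v₁ v'

  R1ₘ : MergePred → MergePred
  R1ₘ M v v₀ v₁ v' = M v v₀ v₁ v' × (tr v ≤ tr v')

  R2ₘ : MergePred → MergePred
  R2ₘ M v v₀ v₁ v' =
    M (setTr v ⟨⟩) (setTr v₀ (tr v₀ - tr v)) (setTr v₁ (tr v₁ - tr v))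
      (setTr v' (tr v' - tr v))
    ◁ (tr v ≤ tr v') ▷ M v v₀ v₁ v'

  R3ₘ : MergePred → MergePred
  R3ₘ M v v₀ v₁ v' = II v v' ◁ (wait v ≡ true) ▷ M v v₀ v₁ v'

  Rₘ : MergePred → MergePred
  Rₘ M = R1ₘ (R2ₘ (R3ₘ M))

  Healthyₘ : (MergePred → MergePred) → MergePred → Set
  Healthyₘ H M = H M ≅ₘ M

-- An R-healthy predicate is determined by two facts: in a waiting state it is
-- the identity II, and in an active state it holds exactly when the trace
-- grows and the predicate holds for the trace increment started from the
-- empty trace.  An Rₘ-healthy merge satisfies the same two facts, with all
-- three traces shifted.  Both properties are inherited by P ∥ₘ Q: waiting
-- states pass through P, Q and M unchanged, and a behaviour from an empty
-- trace extends to one from the trace t by prefixing t to the intermediate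
-- traces of P and Q, since (t ⌢ u) - t = u.
module Submission where

open import Defs
open import Data.Bool using (true; false)
open import Data.Product using (_×_; _,_)
open import Data.Sum using (inj₁; inj₂)
open import Data.Empty using (⊥-elim)
open import Relation.Binary.PropositionalEquality
  using (_≡_; _≢_; refl; sym; trans; cong; subst; subst₂)
open import Function.Bundles using (_⇔_; mk⇔; Equivalence)
open import Function.Construct.Symmetry using (⇔-sym)
open import Function.Construct.Composition using (_⇔-∘_)

module TraceProperties (𝒯 : TraceAlgebra) where
  open TraceAlgebra 𝒯

  ⟨⟩≤x : ∀ x → ⟨⟩ ≤ x
  ⟨⟩≤x x = x , sym (unitˡ x)

  x≤x : ∀ x → x ≤ x
  x≤x x = ⟨⟩ , sym (unitʳ x)

  x≤x⌢y : ∀ x y → x ≤ x ⌢ y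
  x≤x⌢y x y = y , refl

  x⌢y-x≡y : ∀ x y → (x ⌢ y) - x ≡ y
  x⌢y-x≡y x y = sym (cancelˡ x y ((x ⌢ y) - x) (-‿≤ x (x ⌢ y) (x≤x⌢y x y)))

  x-x≡⟨⟩ : ∀ x → x - x ≡ ⟨⟩
  x-x≡⟨⟩ x = subst (λ y → y - x ≡ ⟨⟩) (unitʳ x) (x⌢y-x≡y x ⟨⟩)

  x≤y∧y-x≡⟨⟩⇒y≡x : ∀ {x y} → x ≤ y → y - x ≡ ⟨⟩ → y ≡ x
  x≤y∧y-x≡⟨⟩⇒y≡x {x} {y} x≤y y-x≡⟨⟩ =
    trans (-‿≤ x y x≤y) (trans (cong (x ⌢_) y-x≡⟨⟩) (unitʳ x))

module Healthiness (𝒯 : TraceAlgebra) (S : Set) where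
  open TraceAlgebra 𝒯
  open TraceProperties 𝒯
  open Theory 𝒯 S
  open Equivalence

  infixl 6 _∖_

  _∖_ : State → T → State
  v ∖ t = setTr v (tr v - t)

  shift : T → State → State
  shift t v = setTr v (t ⌢ tr v)

  shift-∖ : ∀ t v → shift t v ∖ t ≡ v
  shift-∖ t v = cong (setTr v) (x⌢y-x≡y t (tr v))

  setTr-≡⇒≡ : ∀ {u v s s'} → setTr u s ≡ setTr v s' → tr u ≡ tr v → u ≡ v
  setTr-≡⇒≡ {u} {v} u≡v-off-tr tr-≡ =
    trans (cong (λ w → setTr w (tr u)) u≡v-off-tr) (cong (setTr v) tr-≡)

  R-on-waiting : ∀ P {v v'} → wait v ≡ true → R P v v' ⇔ II v v'
  R-on-waiting P {v} {v'} waiting = mk⇔ to′ (λ v'≡v → inj₁ (waiting , v'≡v))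
    where
    to′ : R P v v' → II v v'
    to′ (inj₁ (_ , v'≡v)) = v'≡v
    to′ (inj₂ (active , _)) = ⊥-elim (active waiting)

  R-on-active : ∀ P {v v'} → wait v ≢ true →
    R P v v' ⇔ (tr v ≤ tr v' × P (setTr v ⟨⟩) (v' ∖ tr v))
  R-on-active P {v} {v'} active =
    mk⇔ to′ (λ (grows , p) → inj₂ (active , inj₁ (grows , (p , ⟨⟩≤x _))))
    where
    to′ : R P v v' → tr v ≤ tr v' × P (setTr v ⟨⟩) (v' ∖ tr v)
    to′ (inj₁ (waiting , _)) = ⊥-elim (active waiting)
    to′ (inj₂ (_ , inj₁ (grows , (p , _)))) = grows , p
    to′ (inj₂ (_ , inj₂ (¬grows , (_ , grows)))) = ⊥-elim (¬grows grows)

  Rₘ-on-waiting : ∀ M {v v₀ v₁ v'} → wait v ≡ true → Rₘ M v v₀ v₁ v' ⇔ II v v'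
  Rₘ-on-waiting M {v} {v₀} {v₁} {v'} waiting = mk⇔ to′ from′
    where
    to′ : Rₘ M v v₀ v₁ v' → II v v'
    to′ (inj₁ (grows , inj₁ (_ , v'∖≡v∅)) , _) =
      setTr-≡⇒≡ v'∖≡v∅ (x≤y∧y-x≡⟨⟩⇒y≡x grows (cong tr v'∖≡v∅))
    to′ (inj₁ (_ , inj₂ (active , _)) , _) = ⊥-elim (active waiting)
    to′ (inj₂ (¬grows , _) , grows) = ⊥-elim (¬grows grows)

    from′ : II v v' → Rₘ M v v₀ v₁ v'
    from′ refl =
      inj₁ (x≤x (tr v) , inj₁ (waiting , cong (setTr v) (x-x≡⟨⟩ (tr v)))) , x≤x (tr v)

  Rₘ-on-active : ∀ M {v v₀ v₁ v'} → wait v ≢ true →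
    Rₘ M v v₀ v₁ v' ⇔
      (tr v ≤ tr v' × M (setTr v ⟨⟩) (v₀ ∖ tr v) (v₁ ∖ tr v) (v' ∖ tr v))
  Rₘ-on-active M {v} {v₀} {v₁} {v'} active =
    mk⇔ to′ (λ (grows , m) → inj₁ (grows , inj₂ (active , m)) , grows)
    where
    to′ : Rₘ M v v₀ v₁ v' →
      tr v ≤ tr v' × M (setTr v ⟨⟩) (v₀ ∖ tr v) (v₁ ∖ tr v) (v' ∖ tr v)
    to′ (inj₁ (_ , inj₁ (waiting , _)) , _) = ⊥-elim (active waiting)
    to′ (inj₁ (grows , inj₂ (_ , m)) , _) = grows , m
    to′ (inj₂ (¬grows , _) , grows) = ⊥-elim (¬grows grows)

  R-healthy-intro : ∀ {P} →
    (∀ {v v'} → wait v ≡ true → P v v' ⇔ II v v') →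
    (∀ {v v'} → wait v ≢ true →
      P v v' ⇔ (tr v ≤ tr v' × P (setTr v ⟨⟩) (v' ∖ tr v))) →
    Healthy R P
  R-healthy-intro {P} on-waiting on-active (st true t r) v' =
    ⇔-sym (on-waiting refl) ⇔-∘ R-on-waiting P refl
  R-healthy-intro {P} on-waiting on-active (st false t r) v' =
    ⇔-sym (on-active (λ ())) ⇔-∘ R-on-active P (λ ())

  module _ {P : Pred} (healthy : Healthy R P) {v v' : State} where
    R-healthy-waiting : wait v ≡ true → P v v' ⇔ II v v'
    R-healthy-waiting waiting = R-on-waiting P waiting ⇔-∘ ⇔-sym (healthy v v')

    R-healthy-active : wait v ≢ true →
      P v v' ⇔ (tr v ≤ tr v' × P (setTr v ⟨⟩) (v' ∖ tr v))
    R-healthy-active active = R-on-active P active ⇔-∘ ⇔-sym (healthy v v')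

  module _ {M : MergePred} (healthy : Healthyₘ Rₘ M) {v v₀ v₁ v' : State} where
    Rₘ-healthy-waiting : wait v ≡ true → M v v₀ v₁ v' ⇔ II v v'
    Rₘ-healthy-waiting waiting =
      Rₘ-on-waiting M waiting ⇔-∘ ⇔-sym (healthy v v₀ v₁ v')

    Rₘ-healthy-active : wait v ≢ true →
      M v v₀ v₁ v' ⇔
        (tr v ≤ tr v' × M (setTr v ⟨⟩) (v₀ ∖ tr v) (v₁ ∖ tr v) (v' ∖ tr v))
    Rₘ-healthy-active active =
      Rₘ-on-active M active ⇔-∘ ⇔-sym (healthy v v₀ v₁ v')

  module _ {P Q : Pred} {M : MergePred}
           (P-healthy : Healthy R P) (Q-healthy : Healthy R Q)
           (M-healthy : Healthyₘ Rₘ M) {v v' : State} where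

    ParMerge-waiting : wait v ≡ true → ParMerge P M Q v v' ⇔ II v v'
    ParMerge-waiting waiting = mk⇔ to′ from′
      where
      to′ : ParMerge P M Q v v' → II v v'
      to′ (_ , _ , _ , _ , _ , refl , m) =
        to (Rₘ-healthy-waiting M-healthy waiting) m

      from′ : II v v' → ParMerge P M Q v v'
      from′ refl =
        v , v , v ,
        from (R-healthy-waiting P-healthy waiting) refl ,
        from (R-healthy-waiting Q-healthy waiting) refl ,
        refl ,
        from (Rₘ-healthy-waiting M-healthy waiting) refl

    ParMerge-active : wait v ≢ true →
      ParMerge P M Q v v' ⇔
        (tr v ≤ tr v' × ParMerge P M Q (setTr v ⟨⟩) (v' ∖ tr v))
    ParMerge-active active = mk⇔ to′ from′
      where
      t = tr v

      to′ : ParMerge P M Q v v' →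
        t ≤ tr v' × ParMerge P M Q (setTr v ⟨⟩) (v' ∖ t)
      to′ (v₀ , v₁ , _ , p , q , refl , m)
        with to (R-healthy-active P-healthy active) p
           | to (R-healthy-active Q-healthy active) q
           | to (Rₘ-healthy-active M-healthy active) m
      ... | _ , p′ | _ , q′ | grows , m′ =
        grows , (v₀ ∖ t , v₁ ∖ t , setTr v ⟨⟩ , p′ , q′ , refl , m′)

      from′ : t ≤ tr v' × ParMerge P M Q (setTr v ⟨⟩) (v' ∖ t) →
        ParMerge P M Q v v'
      from′ (grows , u₀ , u₁ , _ , p , q , refl , m) =
        shift t u₀ , shift t u₁ , v ,
        from (R-healthy-active P-healthy active)
          (x≤x⌢y t (tr u₀) , subst (P (setTr v ⟨⟩)) (sym (shift-∖ t u₀)) p) ,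
        from (R-healthy-active Q-healthy active)
          (x≤x⌢y t (tr u₁) , subst (Q (setTr v ⟨⟩)) (sym (shift-∖ t u₁)) q) ,
        refl ,
        from (Rₘ-healthy-active M-healthy active)
          (grows , subst₂ (λ w₀ w₁ → M (setTr v ⟨⟩) w₀ w₁ (v' ∖ t))
                          (sym (shift-∖ t u₀)) (sym (shift-∖ t u₁)) m)

theorem15 : (𝒯 : TraceAlgebra) (S : Set) →
    let open Theory 𝒯 S in
    (P Q : Pred) (M : MergePred) →
    Healthy R P → Healthy R Q → Healthyₘ Rₘ M →
    Healthy R (ParMerge P M Q)
theorem15 𝒯 S P Q M P-healthy Q-healthy M-healthy =
  R-healthy-intro
    (ParMerge-waiting P-healthy Q-healthy M-healthy)
    (ParMerge-active P-healthy Q-healthy M-healthy)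
  where open Healthiness 𝒯 S
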